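{- Let $m\ge 1$ and let $n_1,\dots,n_m$ be odd integers with $n_i\ge 3$. Let $\mathcal{C}=\mathcal{C}(C_{n_1},\dots,C_{n_m})$ be the chain cycle obtained from pairwise disjoint cycles $C_{n_1},\dots,C_{n_m}$, where $V(C_{n_i})=\{v^i_1,\dots,v^i_{n_i}\}$ with $v^i_j$ adjacent to $v^i_{j+1}$ ($1\le j<n_i$) and $v^i_{n_i}$ adjacent to $v^i_1$, by identifying the vertex $v^i_{\frac{n_i+1}{2}+1}$ with the vertex $v^{i+1}_1$ for each $i=1,\dots,m-1$. Then the partition dimension of $\mathcal{C}$ is $pd(\mathcal{C})=3$.
   Context: For a connected graph $G$ and an ordered partition $\Pi=\{Q_1,\dots,Q_k\}$ of $V(G)$, the representation of $v\in V(G)$ with respect to $\Pi$ is $r(v|\Pi)=(d(v,Q_1),\dots,d(v,Q_k))$, where $d(v,Q_i)=\min\{d(v,q): q\in Q_i\}$ and $d$ is the shortest-path distance. $\Pi$ is a resolving partition if $r(u|\Pi)\ne r(v|\Pi)$ for all distinct $u,v\in V(G)$. The partition dimension $pd(G)$ is the minimum $k$ for which $G$ has a resolving $k$-partition. -}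

module Defs where

open import Data.Nat using (ℕ; zero; suc; _+_; _*_; _∸_; _≤_; _<_)
open import Data.Nat.DivMod using (_/_)
open import Data.Nat.Base using (_≡ᵇ_; _≤ᵇ_)
open import Data.Bool using (Bool; true; false; _∧_; _∨_; not; T; if_then_else_)
open import Data.Fin using (Fin)
open import Data.Product using (Σ; ∃; _×_; _,_; proj₁)
open import Data.Sum using (_⊎_)
open import Relation.Binary.PropositionalEquality using (_≡_)
open import Function.Bundles using (_⇔_)

record Graph : Set₁ where
  field
    V   : Set
    Adj : V → V → Set

module _ (G : Graph) where
  open Graph G

  data Walk : V → V → ℕ → Set where
    here : ∀ {u} → Walk u u 0
    step : ∀ {u w v ℓ} → Adj u w → Walk w v ℓ → Walk u v (suc ℓ)

  IsDist : V → V → ℕ → Set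
  IsDist u v d = Walk u v d × (∀ ℓ → Walk u v ℓ → d ≤ ℓ)

  record Partition (k : ℕ) : Set where
    field
      cls      : V → Fin k
      nonempty : (i : Fin k) → Σ V (λ q → cls q ≡ i)

  module _ {k : ℕ} (Π : Partition k) where
    open Partition Π

    IsSetDist : V → Fin k → ℕ → Set
    IsSetDist v i d =
      (Σ V λ q → cls q ≡ i × IsDist v q d) ×
      (∀ q e → cls q ≡ i → IsDist v q e → d ≤ e)

    SameRep : V → V → Set
    SameRep u v = ∀ (i : Fin k) (d : ℕ) → IsSetDist u i d ⇔ IsSetDist v i d

    Resolving : Set
    Resolving = ∀ u v → SameRep u v → u ≡ v

  PartitionDimension : ℕ → Set
  PartitionDimension k =
    (Σ (Partition k) Resolving) ×
    (∀ k′ → Σ (Partition k′) Resolving → k ≤ k′)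

Odd : ℕ → Set
Odd n = Σ ℕ λ t → n ≡ suc (2 * t)

-- Cycles are indexed 1..m, vertex v^i_j of C_{n_i} is the raw pair (i , j)
-- with 1 ≤ j ≤ n i.  For 2 ≤ i, the vertex v^i_1 is identified with
-- v^{i-1}_{(n_{i-1}+1)/2 + 1}; we use the latter as representative.

module _ (m : ℕ) (n : ℕ → ℕ) where

  canon : ℕ × ℕ → ℕ × ℕ
  canon (i , j) =
    if (2 ≤ᵇ i) ∧ (j ≡ᵇ 1)
    then (i ∸ 1 , (n (i ∸ 1) + 1) / 2 + 1)
    else (i , j)

  rawValid : ℕ × ℕ → Bool
  rawValid (i , j) = (1 ≤ᵇ i) ∧ (i ≤ᵇ m) ∧ (1 ≤ᵇ j) ∧ (j ≤ᵇ n i)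

  isRep : ℕ × ℕ → Bool
  isRep (i , j) = rawValid (i , j) ∧ not ((2 ≤ᵇ i) ∧ (j ≡ᵇ 1))

  ChainVertex : Set
  ChainVertex = Σ (ℕ × ℕ) λ p → T (isRep p)

  CycleEdge : ℕ → ℕ → ℕ → Set
  CycleEdge i j j′ =
    1 ≤ i × i ≤ m × 1 ≤ j × ((j < n i × j′ ≡ suc j) ⊎ (j ≡ n i × j′ ≡ 1))

  ChainAdj : ChainVertex → ChainVertex → Set
  ChainAdj u v =
    Σ ℕ λ i → Σ ℕ λ j → Σ ℕ λ j′ → CycleEdge i j j′ ×
      ((canon (i , j) ≡ proj₁ u × canon (i , j′) ≡ proj₁ v) ⊎
       (canon (i , j) ≡ proj₁ v × canon (i , j′) ≡ proj₁ u))

  ChainCycle : Graph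
  ChainCycle = record { V = ChainVertex ; Adj = ChainAdj }

module Submission where

open import Defs
open import Data.Nat using (ℕ; zero; suc; _+_; _*_; _∸_; _⊓_; _≤_; _<_; z≤n; s≤s; _≟_; _≤?_; _<?_)
open import Data.Nat.Properties
open import Data.Nat.DivMod using (_/_; m*n/n≡m)
open import Data.Bool using (true; false; _∧_; not; T)
open import Data.Bool.Properties using (T-irrelevant; T-∧)
open import Data.Fin using (Fin; zero; suc)
import Data.Fin.Properties as Fin
open import Data.Product using (Σ; _×_; _,_; proj₁; proj₂)
open import Data.Sum using (_⊎_; inj₁; inj₂)
open import Data.Empty using (⊥; ⊥-elim)
open import Data.Unit using (tt)
open import Relation.Nullary using (Dec; yes; no; ¬_)
open import Relation.Nullary.Decidable using (¬?; _×-dec_; decidable-stable)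
open import Relation.Unary using (Decidable)
open import Relation.Binary.PropositionalEquality
open import Function.Base using (_∘_)
open import Function.Bundles using (mk⇔; Equivalence)
open import Data.Nat.Tactic.RingSolver using (solve-∀)
open import Relation.Binary.Definitions using (tri<; tri≈; tri>)

-- Write n_i = 2 t_i + 1 and let r = v^1_1.  The partition
-- {r}, "near halves" {v^i_j : 2 ≤ j ≤ t_i + 1} and "far halves"
-- {v^i_j : t_i + 2 ≤ j ≤ n_i} is resolving: d(v^i_j, r) equals the potential
-- S_i + cd_i(j), where S_i = t_1 + … + t_{i-1} and cd_i(j) is the distance
-- from v^i_1 to v^i_j inside C_{n_i}; on each half cd_i(j) ranges over
-- [1, t_i], so the bands S_i + [1, t_i] being disjoint, the class of a
-- vertex together with its distance to r determines it.
--
-- In a resolving 2-partition each class has at most one vertex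
-- with a neighbour in the other class.  On a cycle of length ≥ 3 this forces
-- a constant colouring; since v^{i+1}_1 lies on C_{n_i}, every vertex then
-- falls into the class of r, leaving the other class empty.  With a single
-- class, v^1_1 and v^1_2 both have representation (0).

other-colour-unique : {a b c : Fin 2} → a ≢ c → b ≢ c → a ≡ b
other-colour-unique {zero}     {zero}     {_}        _  _  = refl
other-colour-unique {suc zero} {suc zero} {_}        _  _  = refl
other-colour-unique {zero}     {suc zero} {zero}     a≢ _  = ⊥-elim (a≢ refl)
other-colour-unique {zero}     {suc zero} {suc zero} _  b≢ = ⊥-elim (b≢ refl)
other-colour-unique {suc zero} {zero}     {zero}     _  b≢ = ⊥-elim (b≢ refl)
other-colour-unique {suc zero} {zero}     {suc zero} a≢ _  = ⊥-elim (a≢ refl)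

⊓-successor-close : ∀ a c → a ⊓ suc c ≤ suc (suc a ⊓ c) × suc a ⊓ c ≤ suc (a ⊓ suc c)
⊓-successor-close a c =
  ≤-trans (⊓-monoˡ-≤ (suc c) (n≤1+n a)) (s≤s (⊓-monoˡ-≤ c (n≤1+n a))) ,
  ≤-trans (⊓-monoʳ-≤ (suc a) (n≤1+n c)) (s≤s (⊓-monoʳ-≤ a (n≤1+n c)))

+-shift : ∀ s {x y} → x ≤ suc y → s + x ≤ suc (s + y)
+-shift s {y = y} x≤ = ≤-trans (+-monoʳ-≤ s x≤) (≤-reflexive (+-suc s y))

T-not⇒¬T : ∀ b → T (not b) → ¬ T b
T-not⇒¬T false _ ()

¬T⇒T-not : ∀ b → ¬ T b → T (not b)
¬T⇒T-not true  ¬t = ¬t tt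
¬T⇒T-not false _  = tt

crossing : ∀ {ℓ} (P : ℕ → Set ℓ) → Decidable P → ∀ {a b} → a ≤ b → P a → ¬ P b →
  Σ ℕ λ s → a ≤ s × s < b × P s × ¬ P (suc s)
crossing P P? {a} {zero} z≤n pa ¬pb = ⊥-elim (¬pb pa)
crossing P P? {a} {suc b} a≤1+b pa ¬pb with m≤n⇒m<n∨m≡n a≤1+b
... | inj₂ refl = ⊥-elim (¬pb pa)
... | inj₁ (s≤s a≤b) with P? b
...   | yes pb = b , a≤b , ≤-refl , pb , ¬pb
...   | no ¬pb′ with crossing P P? a≤b pa ¬pb′
...     | s , a≤s , s<b , ps , ¬ps = s , a≤s , m<n⇒m<1+n s<b , ps , ¬ps

half : ℕ → ℕ
half N = (N + 1) / 2 ∸ 1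

odd-half : ∀ s → (suc (2 * s) + 1) / 2 ≡ suc s
odd-half s = trans (cong (_/ 2) (double-succ s)) (m*n/n≡m (suc s) 2)
  where
    double-succ : ∀ s → suc (2 * s) + 1 ≡ suc s * 2
    double-succ = solve-∀

odd-midpoint : ∀ {N} → Odd N → (N + 1) / 2 ≡ suc (half N)
odd-midpoint (s , refl) rewrite odd-half s = refl

odd-size : ∀ {N} → Odd N → N ≡ suc (half N + half N)
odd-size (s , refl) rewrite odd-half s = cong (λ x → suc (s + x)) (+-identityʳ s)

half-positive : ∀ {N} → Odd N → 3 ≤ N → 1 ≤ half N
half-positive (zero  , refl) (s≤s ())
half-positive (suc s , refl) _ rewrite odd-half (suc s) = s≤s z≤n

-- The partial sums S i = f 1 + … + f (i-1) of a sequence f.  The bands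
-- S i + [1 , f i] (i ≥ 1) are pairwise disjoint, since S (i+1) = S i + f i.
module PartialSums (f : ℕ → ℕ) where

  S : ℕ → ℕ
  S zero          = 0
  S (suc zero)    = 0
  S (suc (suc k)) = S (suc k) + f (suc k)

  S-suc : ∀ {i} → 1 ≤ i → S (suc i) ≡ S i + f i
  S-suc (s≤s z≤n) = refl

  S-increasing : ∀ i → S i ≤ S (suc i)
  S-increasing zero    = z≤n
  S-increasing (suc k) = m≤m+n (S (suc k)) (f (suc k))

  S-mono : ∀ {a b} → a ≤ b → S a ≤ S b
  S-mono {b = zero} z≤n = ≤-refl
  S-mono {a} {suc b} a≤1+b with m≤n⇒m<n∨m≡n a≤1+b
  ... | inj₂ refl       = ≤-refl
  ... | inj₁ (s≤s a≤b) = ≤-trans (S-mono a≤b) (S-increasing b)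

  band-below : ∀ {i i′ x y} → 1 ≤ i → i < i′ → x ≤ f i → 1 ≤ y → S i + x < S i′ + y
  band-below {i} {i′} {x} {y} 1≤i i<i′ x≤ 1≤y = begin-strict
    S i + x     ≤⟨ +-monoʳ-≤ (S i) x≤ ⟩
    S i + f i   ≡⟨ sym (S-suc 1≤i) ⟩
    S (suc i)   ≤⟨ S-mono i<i′ ⟩
    S i′        <⟨ m<m+n (S i′) 1≤y ⟩
    S i′ + y    ∎
    where open ≤-Reasoning

  band-disjoint : ∀ {i i′ x y} → 1 ≤ i → 1 ≤ i′ →
    1 ≤ x → x ≤ f i → 1 ≤ y → y ≤ f i′ → S i + x ≡ S i′ + y → i ≡ i′
  band-disjoint {i} {i′} 1≤i 1≤i′ 1≤x x≤ 1≤y y≤ eq with <-cmp i i′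
  ... | tri< i<i′ _ _ = ⊥-elim (<-irrefl eq (band-below 1≤i i<i′ x≤ 1≤y))
  ... | tri≈ _ i≡i′ _ = i≡i′
  ... | tri> _ _ i′<i = ⊥-elim (<-irrefl (sym eq) (band-below 1≤i′ i′<i y≤ 1≤x))

module GraphFacts (G : Graph) where
  open Graph G

  walk-zero : ∀ {u v} → Walk G u v 0 → u ≡ v
  walk-zero here = refl

  -- A potential φ that vanishes at r, drops by at most one along an edge,
  -- and away from r drops by exactly one along some edge, is d(·, r):
  -- the drops give a walk of length φ u, and no walk can be shorter.
  potential-is-distance : (r : V) (φ : V → ℕ) → φ r ≡ 0 →
    (∀ {u w} → Adj u w → φ u ≤ suc (φ w)) →
    (∀ u → u ≡ r ⊎ Σ V λ w → Adj u w × suc (φ w) ≡ φ u) →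
    ∀ u → IsDist G u r (φ u)
  potential-is-distance r φ φr≡0 lipschitz descent u =
    descend (φ u) u refl , λ _ → walk-bound
    where
      walk-bound : ∀ {v ℓ} → Walk G v r ℓ → φ v ≤ ℓ
      walk-bound here       = ≤-reflexive φr≡0
      walk-bound (step a w) = ≤-trans (lipschitz a) (s≤s (walk-bound w))

      descend : ∀ d v → φ v ≡ d → Walk G v r d
      descend d v φv≡d with descent v
      descend zero    v φv≡d | inj₁ refl = here
      descend (suc d) v φv≡d | inj₁ refl = ⊥-elim (0≢1+n (trans (sym φr≡0) φv≡d))
      descend zero    v φv≡d | inj₂ (w , a , drop) = ⊥-elim (1+n≢0 (trans drop φv≡d))
      descend (suc d) v φv≡d | inj₂ (w , a , drop) =
        step a (descend d w (suc-injective (trans drop φv≡d)))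

  module _ {k : ℕ} (Π : Partition G k) where
    open Partition Π

    set-distance-unique : ∀ {x i d d′} →
      IsSetDist G Π x i d → IsSetDist G Π x i d′ → d ≡ d′
    set-distance-unique ((q , cq , dq) , min) ((q′ , cq′ , dq′) , min′) =
      ≤-antisym (min q′ _ cq′ dq′) (min′ q _ cq dq)

    same-rep-from-agreement : ∀ {x y} →
      (∀ i → Σ ℕ λ d → IsSetDist G Π x i d × IsSetDist G Π y i d) →
      SameRep G Π x y
    same-rep-from-agreement {x} {y} agree i d with agree i
    ... | e , dx , dy =
      mk⇔ (λ s → subst (IsSetDist G Π y i) (set-distance-unique dx s) dy)
          (λ s → subst (IsSetDist G Π x i) (set-distance-unique dy s) dx)

    own-class-distance : ∀ x → IsSetDist G Π x (cls x) 0
    own-class-distance x = (x , refl , here , λ _ _ → z≤n) , λ _ _ _ _ → z≤n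

    neighbour-class-distance : ∀ x x′ → Adj x x′ → cls x′ ≢ cls x →
      IsSetDist G Π x (cls x′) 1
    neighbour-class-distance x x′ a other =
      (x′ , refl , step a here , λ { zero w → ⊥-elim (other (cong cls (sym (walk-zero w))))
                                   ; (suc ℓ) _ → s≤s z≤n })
      , λ { q zero cq (w , _) → ⊥-elim (other (trans (sym cq) (cong cls (sym (walk-zero w)))))
          ; q (suc e) _ _ → s≤s z≤n }

    same-rep-same-class : ∀ {u v} → SameRep G Π u v → cls u ≡ cls v
    same-rep-same-class {u} sr with Equivalence.to (sr (cls u) 0) (own-class-distance u)
    ... | (q , cq , w , _) , _ = sym (trans (cong cls (walk-zero w)) cq)

    singleton-class-resolves : (r : V) → (∀ q → cls q ≡ cls r → q ≡ r) →
      (φ : V → ℕ) → (∀ u → IsDist G u r (φ u)) →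
      (∀ u v → cls u ≡ cls v → φ u ≡ φ v → u ≡ v) → Resolving G Π
    singleton-class-resolves r singleton φ dist separates u v sr =
      separates u v (same-rep-same-class sr)
        (set-distance-unique (Equivalence.to (sr (cls r) (φ u)) (to-root u)) (to-root v))
      where
        to-root : ∀ x → IsSetDist G Π x (cls r) (φ x)
        to-root x = (r , refl , dist x) , λ q e cq dq →
          proj₂ (dist x) e (subst (λ z → Walk G x z e) (singleton q cq) (proj₁ dq))

  -- In a resolving 2-partition, each class has at most one vertex with a
  -- neighbour in the other class: all such vertices have representation
  -- 0 at their own class and 1 at the other one.
  boundary-unique : (Π : Partition G 2) → Resolving G Π → let open Partition Π in
    ∀ {x y x′ y′} → cls x ≡ cls y → Adj x x′ → cls x′ ≢ cls x →
    Adj y y′ → cls y′ ≢ cls y → x ≡ y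
  boundary-unique Π resolving {x} {y} {x′} {y′} same ax x′-other ay y′-other =
    resolving x y (same-rep-from-agreement Π agree)
    where
      open Partition Π
      agree : ∀ i → Σ ℕ λ d → IsSetDist G Π x i d × IsSetDist G Π y i d
      agree i with i Fin.≟ cls x
      ... | yes refl =
        0 , own-class-distance Π x
          , subst (λ c → IsSetDist G Π y c 0) (sym same) (own-class-distance Π y)
      ... | no i≢ =
        1 , subst (λ c → IsSetDist G Π x c 1) (other-colour-unique x′-other i≢)
                  (neighbour-class-distance Π x x′ ax x′-other)
          , subst (λ c → IsSetDist G Π y c 1)
                  (other-colour-unique (λ e → y′-other (trans e same)) i≢)
                  (neighbour-class-distance Π y y′ ay y′-other)

  -- A graph with two distinct vertices and no resolving 2-partition needs
  -- at least three classes: with none, a vertex has no class, and with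
  -- one, all representations are (0).
  three-classes-needed : (x y : V) → x ≢ y →
    (∀ (Π : Partition G 2) → ¬ Resolving G Π) →
    ∀ k → Σ (Partition G k) (Resolving G) → 3 ≤ k
  three-classes-needed x y x≢y no-two zero (Π , _) with Partition.cls Π x
  ... | ()
  three-classes-needed x y x≢y no-two (suc zero) (Π , resolving) =
    ⊥-elim (x≢y (resolving x y (same-rep-from-agreement Π agree)))
    where
      open Partition Π
      single-class : ∀ z → cls z ≡ zero
      single-class z with cls z
      ... | zero = refl
      agree : ∀ i → Σ ℕ λ d → IsSetDist G Π x i d × IsSetDist G Π y i d
      agree zero =
        0 , subst (λ c → IsSetDist G Π x c 0) (single-class x) (own-class-distance Π x)
          , subst (λ c → IsSetDist G Π y c 0) (single-class y) (own-class-distance Π y)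
  three-classes-needed x y x≢y no-two (suc (suc zero)) (Π , resolving) =
    ⊥-elim (no-two Π resolving)
  three-classes-needed x y x≢y no-two (suc (suc (suc k))) _ = s≤s (s≤s (s≤s z≤n))

module CycleColouring (N : ℕ) (N≥3 : 3 ≤ N) (c : ℕ → Fin 2) where

  Step : ℕ → ℕ → Set
  Step p q = (1 ≤ p × p < N × q ≡ suc p) ⊎ (p ≡ N × q ≡ 1)

  Link : ℕ → ℕ → Set
  Link p q = Step p q ⊎ Step q p

  Boundary : ℕ → Set
  Boundary p = Σ ℕ λ q → Link p q × c q ≢ c p

  -- Otherwise let p be the last position before the first
  -- colour change.  If c N ≠ c 1, the positions p and 1 are boundary of
  -- colour c 1 and p+1, N boundary of the other one, so N = 2.  If c N = c 1,
  -- the colour changes back at some q → q+1 after p, and p = q+1 is absurd.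
  monochromatic :
    (∀ {p p′} → Boundary p → Boundary p′ → c p ≡ c p′ → p ≡ p′) →
    ∀ {j} → 1 ≤ j → j ≤ N → c j ≡ c 1
  monochromatic unique {j} 1≤j j≤N with c j Fin.≟ c 1
  ... | yes same = same
  ... | no changed
    with crossing (λ x → c x ≡ c 1) (λ x → c x Fin.≟ c 1) 1≤j refl changed
  ... | p , 1≤p , p<j , cp≡ , cp+1≢ = ⊥-elim (by-colour-of-N (c N Fin.≟ c 1))
    where
      p<N : p < N
      p<N = ≤-trans p<j j≤N

      boundary-p : Boundary p
      boundary-p = suc p , inj₁ (inj₁ (1≤p , p<N , refl)) , λ e → cp+1≢ (trans e cp≡)

      by-colour-of-N : Dec (c N ≡ c 1) → ⊥
      by-colour-of-N (no cN≢) = <-irrefl (sym N≡2) N≥3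
        where
          boundary-1 : Boundary 1
          boundary-1 = N , inj₂ (inj₂ (refl , refl)) , cN≢
          boundary-p+1 : Boundary (suc p)
          boundary-p+1 = p , inj₂ (inj₁ (1≤p , p<N , refl)) , λ e → cp+1≢ (trans (sym e) cp≡)
          boundary-N : Boundary N
          boundary-N = 1 , inj₁ (inj₂ (refl , refl)) , λ e → cN≢ (sym e)
          N≡2 : N ≡ 2
          N≡2 = begin
            N     ≡⟨ sym (unique boundary-p+1 boundary-N (other-colour-unique cp+1≢ cN≢)) ⟩
            suc p ≡⟨ cong suc (unique boundary-p boundary-1 cp≡) ⟩
            2     ∎
            where open ≡-Reasoning
      by-colour-of-N (yes cN≡)
        with crossing (λ x → c x ≢ c 1) (λ x → ¬? (c x Fin.≟ c 1)) j≤N changed (λ differ → differ cN≡)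
      ... | q , j≤q , q<N , cq≢ , ¬cq+1≢ =
        <-irrefl (unique boundary-p boundary-q+1 (trans cp≡ (sym cq+1≡)))
                 (≤-trans p<j (m≤n⇒m≤1+n j≤q))
        where
          cq+1≡ : c (suc q) ≡ c 1
          cq+1≡ = decidable-stable (c (suc q) Fin.≟ c 1) ¬cq+1≢
          boundary-q+1 : Boundary (suc q)
          boundary-q+1 = q , inj₂ (inj₁ (≤-trans 1≤j j≤q , q<N , refl))
                           , λ e → cq≢ (trans e cq+1≡)

module ChainCycleProof (m : ℕ) (n : ℕ → ℕ) (m≥1 : 1 ≤ m)
       (shape : ∀ i → 1 ≤ i → i ≤ m → 3 ≤ n i × Odd (n i)) where

  G : Graph
  G = ChainCycle m n

  V : Set
  V = ChainVertex m n

  open GraphFacts G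

  IsCycle : ℕ → Set
  IsCycle i = 1 ≤ i × i ≤ m

  Valid : ℕ → ℕ → Set
  Valid i j = IsCycle i × 1 ≤ j × j ≤ n i

  valid? : ∀ i j → Dec (Valid i j)
  valid? i j = ((1 ≤? i) ×-dec (i ≤? m)) ×-dec (1 ≤? j) ×-dec (j ≤? n i)

  -- n_i = 2 t_i + 1, and the vertex v^i_{t_i + 2} is glued to v^{i+1}_1.
  t : ℕ → ℕ
  t i = half (n i)

  module _ {i} (ci : IsCycle i) where

    cycle-long : 3 ≤ n i
    cycle-long = proj₁ (shape i (proj₁ ci) (proj₂ ci))

    cycle-size : n i ≡ suc (t i + t i)
    cycle-size = odd-size (proj₂ (shape i (proj₁ ci) (proj₂ ci)))

    t-positive : 1 ≤ t i
    t-positive = half-positive (proj₂ (shape i (proj₁ ci) (proj₂ ci))) cycle-long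

    junction-position : (n i + 1) / 2 + 1 ≡ suc (suc (t i))
    junction-position =
      trans (+-comm _ 1) (cong suc (odd-midpoint (proj₂ (shape i (proj₁ ci) (proj₂ ci)))))

    junction-valid : Valid i (suc (suc (t i)))
    junction-valid = ci , s≤s z≤n ,
      subst (suc (suc (t i)) ≤_) (sym cycle-size) (s≤s (+-monoˡ-≤ (t i) t-positive))

  root-cycle : IsCycle 1
  root-cycle = s≤s z≤n , m≥1

  previous-cycle : ∀ {k} → IsCycle (suc (suc k)) → IsCycle (suc k)
  previous-cycle (_ , k+2≤m) = s≤s z≤n , ≤-trans (n≤1+n _) k+2≤m

  Glued : ℕ → ℕ → Set
  Glued i j = 2 ≤ i × j ≡ 1

  rep-decode : ∀ i j → T (isRep m n (i , j)) → Valid i j × ¬ Glued i j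
  rep-decode i j r with Equivalence.to T-∧ r
  ... | raw , not-glued with Equivalence.to T-∧ raw
  ... | 1≤i , rest with Equivalence.to T-∧ rest
  ... | i≤m , rest′ with Equivalence.to T-∧ rest′
  ... | 1≤j , j≤n =
    ((≤ᵇ⇒≤ 1 i 1≤i , ≤ᵇ⇒≤ i m i≤m) , ≤ᵇ⇒≤ 1 j 1≤j , ≤ᵇ⇒≤ j (n i) j≤n) ,
    λ (2≤i , j≡1) →
      T-not⇒¬T _ not-glued (Equivalence.from T-∧ (≤⇒≤ᵇ 2≤i , ≡⇒≡ᵇ j 1 j≡1))

  rep-encode : ∀ {i j} → Valid i j → ¬ Glued i j → T (isRep m n (i , j))
  rep-encode {i} {j} ((1≤i , i≤m) , 1≤j , j≤n) not-glued =
    Equivalence.from T-∧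
      ( Equivalence.from T-∧ (≤⇒≤ᵇ 1≤i , Equivalence.from T-∧ (≤⇒≤ᵇ i≤m ,
          Equivalence.from T-∧ (≤⇒≤ᵇ 1≤j , ≤⇒≤ᵇ j≤n)))
      , ¬T⇒T-not _ λ glued → let (2≤i , j≡1) = Equivalence.to T-∧ glued in
          not-glued (≤ᵇ⇒≤ 2 i 2≤i , ≡ᵇ⇒≡ j 1 j≡1))

  canon-rep : ∀ {i j} → ¬ Glued i j → canon m n (i , j) ≡ (i , j)
  canon-rep {zero}                       _ = refl
  canon-rep {suc zero}                   _ = refl
  canon-rep {suc (suc k)} {zero}         _ = refl
  canon-rep {suc (suc k)} {suc zero}     not-glued = ⊥-elim (not-glued (s≤s (s≤s z≤n) , refl))
  canon-rep {suc (suc k)} {suc (suc l)}  _ = refl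

  canon-valid : ∀ {i j} → Valid i j → T (isRep m n (canon m n (i , j)))
  canon-valid {suc zero}                 v = rep-encode v λ { (s≤s () , _) }
  canon-valid {suc (suc k)} {suc zero}   (ci , _) =
    subst (λ j → T (isRep m n (suc k , j))) (sym (junction-position (previous-cycle ci)))
      (rep-encode (junction-valid (previous-cycle ci)) λ { (_ , ()) })
  canon-valid {suc (suc k)} {suc (suc l)} v = rep-encode v λ { (_ , ()) }

  vertex : ∀ i j → Valid i j → V
  vertex i j v = canon m n (i , j) , canon-valid v

  vertex-≡ : ∀ {u w : V} → proj₁ u ≡ proj₁ w → u ≡ w
  vertex-≡ {p , x} {.p , y} refl = cong (p ,_) (T-irrelevant x y)

  vertex-self : ∀ i j (r : T (isRep m n (i , j))) →
    ((i , j) , r) ≡ vertex i j (proj₁ (rep-decode i j r))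
  vertex-self i j r = vertex-≡ (sym (canon-rep (proj₂ (rep-decode i j r))))

  glued : ∀ {i} (ci : IsCycle i) (v : Valid (suc i) 1) →
    vertex (suc i) 1 v ≡ vertex i (suc (suc (t i))) (junction-valid ci)
  glued {suc k} ci v =
    vertex-≡ (trans (cong (suc k ,_) (junction-position ci)) (sym (canon-rep λ { (_ , ()) })))

  -- Distinct positions of one cycle are distinct vertices (a glued name
  -- lands in the previous cycle, so it cannot collide with a position of
  -- its own cycle).
  canon-injective : ∀ {i j j′} → 1 ≤ j → 1 ≤ j′ →
    canon m n (i , j) ≡ canon m n (i , j′) → j ≡ j′
  canon-injective {zero}      _ _ e = cong proj₂ e
  canon-injective {suc zero}  _ _ e = cong proj₂ e
  canon-injective {suc (suc k)} {suc zero}    {suc zero}     _ _ _ = refl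
  canon-injective {suc (suc k)} {suc zero}    {suc (suc l′)} _ _ e = ⊥-elim (1+n≢n (sym (cong proj₁ e)))
  canon-injective {suc (suc k)} {suc (suc l)} {suc zero}     _ _ e = ⊥-elim (1+n≢n (cong proj₁ e))
  canon-injective {suc (suc k)} {suc (suc l)} {suc (suc l′)} _ _ e = cong proj₂ e

  vertex-injective : ∀ {i j j′} (v : Valid i j) (v′ : Valid i j′) →
    vertex i j v ≡ vertex i j′ v′ → j ≡ j′
  vertex-injective (_ , 1≤j , _) (_ , 1≤j′ , _) e = canon-injective 1≤j 1≤j′ (cong proj₁ e)

  -- The potential of v^i_j: S i = t_1 + … + t_{i-1} is the distance from
  -- v^1_1 to v^i_1, and cd i j = min(j - 1, n_i + 1 - j) the distance from
  -- v^i_1 to v^i_j inside C_{n_i}.  It will turn out to be d(v^i_j, v^1_1).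
  open PartialSums t using (S; band-disjoint)

  cd : ℕ → ℕ → ℕ
  cd i j = (j ∸ 1) ⊓ (suc (n i) ∸ j)

  potential : ℕ × ℕ → ℕ
  potential (i , j) = S i + cd i j

  φ : V → ℕ
  φ u = potential (proj₁ u)

  module _ {i} (ci : IsCycle i) where

    cd-near : ∀ {j} → 1 ≤ j → j ≤ suc (t i) → cd i j ≡ j ∸ 1
    cd-near {suc a} _ (s≤s a≤t) = m≤n⇒m⊓n≡m (m+n≤o⇒m≤o∸n a (begin
      a + a           ≤⟨ +-mono-≤ a≤t a≤t ⟩
      t i + t i       ≤⟨ n≤1+n _ ⟩
      suc (t i + t i) ≡⟨ sym (cycle-size ci) ⟩
      n i             ∎))
      where open ≤-Reasoning

    cd-far : ∀ {j} → suc (suc (t i)) ≤ j → j ≤ n i → cd i j ≡ suc (n i) ∸ j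
    cd-far {suc a} (s≤s t<a) _ = m≥n⇒m⊓n≡n (m≤n+o⇒m∸n≤o (n i) a (begin
      n i             ≡⟨ cycle-size ci ⟩
      suc (t i) + t i ≤⟨ +-mono-≤ t<a (≤-trans (n≤1+n (t i)) t<a) ⟩
      a + a           ∎))
      where open ≤-Reasoning

    cd-junction : cd i (suc (suc (t i))) ≡ t i
    cd-junction = begin
      cd i (suc (suc (t i)))   ≡⟨ cd-far ≤-refl (proj₂ (proj₂ (junction-valid ci))) ⟩
      n i ∸ suc (t i)          ≡⟨ cong (_∸ suc (t i)) (cycle-size ci) ⟩
      t i + t i ∸ t i          ≡⟨ m+n∸m≡n (t i) (t i) ⟩
      t i                      ∎
      where open ≡-Reasoning

    -- The last vertex v^i_{n_i} is adjacent to v^i_1.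
    cd-last : cd i (n i) ≡ 1
    cd-last = trans (cd-far (proj₂ (proj₂ (junction-valid ci))) ≤-refl) (m+n∸n≡m 1 (n i))

  -- Renaming a glued vertex does not change its potential: the junction
  -- of cycle i lies at distance S i + t_i = S (i+1) from v^1_1.
  canon-potential : ∀ {i j} → Valid i j → potential (canon m n (i , j)) ≡ potential (i , j)
  canon-potential {suc zero}                v = refl
  canon-potential {suc (suc k)} {suc zero}  (ci , _) = begin
    S (suc k) + cd (suc k) ((n (suc k) + 1) / 2 + 1)
      ≡⟨ cong (λ j → S (suc k) + cd (suc k) j) (junction-position ck) ⟩
    S (suc k) + cd (suc k) (suc (suc (t (suc k))))
      ≡⟨ cong (S (suc k) +_) (cd-junction ck) ⟩
    S (suc k) + t (suc k)
      ≡⟨ sym (+-identityʳ _) ⟩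
    S (suc k) + t (suc k) + 0 ∎
    where
      open ≡-Reasoning
      ck : IsCycle (suc k)
      ck = previous-cycle ci
  canon-potential {suc (suc k)} {suc (suc l)} v = refl

  edge-valid : ∀ {i j j′} → CycleEdge m n i j j′ → Valid i j × Valid i j′
  edge-valid {i} (1≤i , i≤m , 1≤j , inj₁ (j<n , refl)) =
    (ci , 1≤j , <⇒≤ j<n) , (ci , s≤s z≤n , j<n)
    where
      ci : IsCycle i
      ci = 1≤i , i≤m
  edge-valid {i} (1≤i , i≤m , 1≤j , inj₂ (refl , refl)) =
    (ci , 1≤j , ≤-refl) , (ci , s≤s z≤n , ≤-trans (s≤s z≤n) (cycle-long ci))
    where
      ci : IsCycle i
      ci = 1≤i , i≤m

  edge-adj : ∀ {i j j′} (e : CycleEdge m n i j j′) →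
    ChainAdj m n (vertex i j (proj₁ (edge-valid e))) (vertex i j′ (proj₂ (edge-valid e)))
  edge-adj {i} {j} {j′} e = i , j , j′ , e , inj₁ (refl , refl)

  edge-adj⁻ : ∀ {i j j′} (e : CycleEdge m n i j j′) →
    ChainAdj m n (vertex i j′ (proj₂ (edge-valid e))) (vertex i j (proj₁ (edge-valid e)))
  edge-adj⁻ {i} {j} {j′} e = i , j , j′ , e , inj₂ (refl , refl)

  cd-step : ∀ {i j j′} → CycleEdge m n i j j′ → cd i j ≤ suc (cd i j′) × cd i j′ ≤ suc (cd i j)
  cd-step {i} (_ , _ , _ , inj₂ (refl , refl)) =
    ≤-trans (m⊓n≤n (n i ∸ 1) (suc (n i) ∸ n i)) (≤-reflexive (m+n∸n≡m 1 (n i))) , z≤n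
  cd-step {i} {suc a} (_ , _ , _ , inj₁ (a<n , refl)) =
    subst (λ c → a ⊓ c ≤ suc (suc a ⊓ (n i ∸ suc a)) × suc a ⊓ (n i ∸ suc a) ≤ suc (a ⊓ c))
          (sym (+-∸-assoc 1 (<⇒≤ a<n))) (⊓-successor-close a (n i ∸ suc a))

  potential-at : ∀ {i j p} → Valid i j → canon m n (i , j) ≡ p → potential p ≡ S i + cd i j
  potential-at v refl = canon-potential v

  φ-lipschitz : ∀ {u w} → ChainAdj m n u w → φ u ≤ suc (φ w)
  φ-lipschitz (i , j , j′ , e , inj₁ (u≡ , w≡)) =
    subst₂ (λ a b → a ≤ suc b)
      (sym (potential-at (proj₁ (edge-valid e)) u≡)) (sym (potential-at (proj₂ (edge-valid e)) w≡))
      (+-shift (S i) (proj₁ (cd-step e)))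
  φ-lipschitz (i , j , j′ , e , inj₂ (w≡ , u≡)) =
    subst₂ (λ a b → a ≤ suc b)
      (sym (potential-at (proj₂ (edge-valid e)) u≡)) (sym (potential-at (proj₁ (edge-valid e)) w≡))
      (+-shift (S i) (proj₂ (cd-step e)))

  root-valid : Valid 1 1
  root-valid = root-cycle , s≤s z≤n , ≤-trans (s≤s z≤n) (cycle-long root-cycle)

  root : V
  root = vertex 1 1 root-valid

  first-position-is-root : ∀ {i} → IsCycle i → ¬ Glued i 1 → i ≡ 1
  first-position-is-root {suc zero}    _ _         = refl
  first-position-is-root {suc (suc k)} _ not-glued = ⊥-elim (not-glued (s≤s (s≤s z≤n) , refl))

  Closer : V → Set
  Closer u = Σ V λ w → ChainAdj m n u w × suc (φ w) ≡ φ u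

  closer-along : ∀ {i j j′} (v : Valid i j) (v′ : Valid i j′) →
    ChainAdj m n (vertex i j v) (vertex i j′ v′) → suc (cd i j′) ≡ cd i j →
    Closer (vertex i j v)
  closer-along {i} {j} {j′} v v′ adj drop = vertex i j′ v′ , adj , (begin
    suc (φ (vertex i j′ v′)) ≡⟨ cong suc (canon-potential v′) ⟩
    suc (S i + cd i j′)      ≡⟨ sym (+-suc (S i) (cd i j′)) ⟩
    S i + suc (cd i j′)      ≡⟨ cong (S i +_) drop ⟩
    S i + cd i j             ≡⟨ sym (canon-potential v) ⟩
    φ (vertex i j v)         ∎)
    where open ≡-Reasoning

  -- Every vertex v^i_j ≠ v^i_1 has a neighbour closer to v^i_1: the previous
  -- one on the near half, the next one on the far half.
  closer-in-cycle : ∀ {i j} (v : Valid i j) → j ≢ 1 → Closer (vertex i j v)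
  closer-in-cycle {i} {j} v@(ci , 1≤j , j≤n) j≢1 with j ≤? suc (t i) | j <? n i
  closer-in-cycle {i} {suc zero} _ j≢1 | _ | _ = ⊥-elim (j≢1 refl)
  closer-in-cycle {i} {suc (suc a)} v@(ci , _ , j≤n) _ | yes near | _ =
    closer-along v (proj₁ (edge-valid e)) (edge-adj⁻ e)
      (trans (cong suc (cd-near ci (s≤s z≤n) (≤-trans (n≤1+n _) near)))
             (sym (cd-near ci (s≤s z≤n) near)))
    where
      e : CycleEdge m n i (suc a) (suc (suc a))
      e = proj₁ ci , proj₂ ci , s≤s z≤n , inj₁ (j≤n , refl)
  ... | no far | yes j<n =
    closer-along v (proj₂ (edge-valid e)) (edge-adj e)
      (trans (cong suc (cd-far ci (≤-trans (≰⇒> far) (n≤1+n j)) j<n))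
             (sym (trans (cd-far ci (≰⇒> far) j≤n) (+-∸-assoc 1 j≤n))))
    where
      e : CycleEdge m n i j (suc j)
      e = proj₁ ci , proj₂ ci , 1≤j , inj₁ (j<n , refl)
  ... | no far | no j≮n =
    closer-along v (proj₂ (edge-valid e)) (edge-adj e)
      (sym (trans (cong (cd i) j≡n) (cd-last ci)))
    where
      j≡n : j ≡ n i
      j≡n = ≤-antisym j≤n (≮⇒≥ j≮n)
      e : CycleEdge m n i j 1
      e = proj₁ ci , proj₂ ci , 1≤j , inj₂ (j≡n , refl)

  φ-descent : ∀ u → u ≡ root ⊎ Closer u
  φ-descent ((i , j) , r) with rep-decode i j r | vertex-self i j r
  ... | v@(ci , _) , not-glued | u≡ with j ≟ 1
  ... | no j≢1  = inj₂ (subst Closer (sym u≡) (closer-in-cycle v j≢1))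
  ... | yes refl with first-position-is-root {i} ci not-glued
  ...   | refl = inj₁ (vertex-≡ refl)

  root-distance : ∀ u → IsDist G u root (φ u)
  root-distance = potential-is-distance root φ refl (λ {u} {w} → φ-lipschitz {u} {w}) φ-descent

  data Region (i j : ℕ) : Fin 3 → Set where
    at-root : j ≡ 1 → Region i j zero
    near    : j ≢ 1 → j ≤ suc (t i) → Region i j (suc zero)
    far     : ¬ j ≤ suc (t i) → Region i j (suc (suc zero))

  region : ℕ × ℕ → Fin 3
  region (i , j) with j ≟ 1 | j ≤? suc (t i)
  ... | yes _ | _     = zero
  ... | no _  | yes _ = suc zero
  ... | no _  | no _  = suc (suc zero)

  region-view : ∀ i j → Region i j (region (i , j))
  region-view i j with j ≟ 1 | j ≤? suc (t i)
  ... | yes j≡1 | _        = at-root j≡1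
  ... | no j≢1  | yes j≤   = near j≢1 j≤
  ... | no _    | no j≰    = far j≰

  region-unique : ∀ {i j c c′} → Region i j c → Region i j c′ → c ≡ c′
  region-unique (at-root _)   (at-root _)    = refl
  region-unique (near _ _)    (near _ _)     = refl
  region-unique (far _)       (far _)        = refl
  region-unique (at-root j≡1) (near j≢1 _)   = ⊥-elim (j≢1 j≡1)
  region-unique (near j≢1 _)  (at-root j≡1)  = ⊥-elim (j≢1 j≡1)
  region-unique (at-root refl) (far j≰)      = ⊥-elim (j≰ (s≤s z≤n))
  region-unique (far j≰) (at-root refl)      = ⊥-elim (j≰ (s≤s z≤n))
  region-unique (near _ j≤)   (far j≰)       = ⊥-elim (j≰ j≤)
  region-unique (far j≰)      (near _ j≤)    = ⊥-elim (j≰ j≤)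

  second-valid : Valid 1 2
  second-valid = root-cycle , s≤s z≤n , ≤-trans (s≤s (s≤s z≤n)) (cycle-long root-cycle)

  second : V
  second = vertex 1 2 second-valid

  root≢second : root ≢ second
  root≢second e = 0≢1+n (suc-injective (cong (proj₂ ∘ proj₁) e))

  Π₃ : Partition G 3
  Π₃ = record { cls = region ∘ proj₁ ; nonempty = witness }
    where
      witness : (c : Fin 3) → Σ V λ q → region (proj₁ q) ≡ c
      witness zero             = root , refl
      witness (suc zero)       =
        second , sym (region-unique (near (λ ()) (s≤s (t-positive root-cycle))) (region-view 1 2))
      witness (suc (suc zero)) =
        vertex 1 (suc (suc (t 1))) (junction-valid root-cycle) ,
        sym (region-unique (far 1+n≰n) (region-view 1 (suc (suc (t 1)))))

  root-alone : ∀ q → region (proj₁ q) ≡ zero → q ≡ root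
  root-alone ((i , j) , r) in-root with rep-decode i j r
  ... | (ci , _) , not-glued
    with subst (Region i j) in-root (region-view i j)
  ... | at-root refl with first-position-is-root {i} ci not-glued
  ...   | refl = vertex-≡ refl

  InBand : ℕ → ℕ → Set
  InBand i c = 1 ≤ c × c ≤ t i

  near-band : ∀ {i j} → IsCycle i → 1 ≤ j → j ≢ 1 → j ≤ suc (t i) → InBand i (cd i j)
  near-band {i} {suc (suc a)} ci _ _ (s≤s a<t) =
    subst (InBand i) (sym (cd-near ci (s≤s z≤n) (s≤s a<t))) (s≤s z≤n , a<t)
  near-band {i} {suc zero} ci _ j≢1 _ = ⊥-elim (j≢1 refl)

  far-band : ∀ {i j} → IsCycle i → j ≤ n i → ¬ j ≤ suc (t i) → InBand i (cd i j)
  far-band {i} {j} ci j≤n j≰ = subst (InBand i) (sym (cd-far ci t<j j≤n))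
    ( m+n≤o⇒m≤o∸n 1 (s≤s j≤n)
    , m≤n+o⇒m∸n≤o (suc (n i)) j (begin
        suc (n i)             ≡⟨ cong suc (cycle-size ci) ⟩
        suc (suc (t i)) + t i ≤⟨ +-monoˡ-≤ (t i) t<j ⟩
        j + t i               ∎))
    where
      open ≤-Reasoning
      t<j : suc (suc (t i)) ≤ j
      t<j = ≰⇒> j≰

  region-potential-injective : ∀ {c i j i′ j′} →
    Valid i j → ¬ Glued i j → Valid i′ j′ → ¬ Glued i′ j′ →
    Region i j c → Region i′ j′ c → potential (i , j) ≡ potential (i′ , j′) →
    (i , j) ≡ (i′ , j′)
  region-potential-injective {i = i} {i′ = i′} (ci , _) ng (ci′ , _) ng′ (at-root refl) (at-root refl) _
    rewrite first-position-is-root {i} ci ng | first-position-is-root {i′} ci′ ng′ = refl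
  region-potential-injective {i = i} {j} {i′} {j′} (ci , 1≤j , _) _ (ci′ , 1≤j′ , _) _
    (near j≢1 j≤) (near j′≢1 j′≤) eq
    with band-disjoint (proj₁ ci) (proj₁ ci′)
           (proj₁ (near-band ci 1≤j j≢1 j≤)) (proj₂ (near-band ci 1≤j j≢1 j≤))
           (proj₁ (near-band ci′ 1≤j′ j′≢1 j′≤)) (proj₂ (near-band ci′ 1≤j′ j′≢1 j′≤)) eq
  ... | refl = cong (i ,_) (∸-cancelʳ-≡ 1≤j 1≤j′ (begin
    j ∸ 1    ≡⟨ sym (cd-near ci 1≤j j≤) ⟩
    cd i j   ≡⟨ +-cancelˡ-≡ (S i) _ _ eq ⟩
    cd i j′  ≡⟨ cd-near ci 1≤j′ j′≤ ⟩
    j′ ∸ 1   ∎))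
    where open ≡-Reasoning
  region-potential-injective {i = i} {j} {i′} {j′} (ci , _ , j≤n) _ (ci′ , _ , j′≤n) _
    (far j≰) (far j′≰) eq
    with band-disjoint (proj₁ ci) (proj₁ ci′)
           (proj₁ (far-band ci j≤n j≰)) (proj₂ (far-band ci j≤n j≰))
           (proj₁ (far-band ci′ j′≤n j′≰)) (proj₂ (far-band ci′ j′≤n j′≰)) eq
  ... | refl = cong (i ,_) (∸-cancelˡ-≡ (m≤n⇒m≤1+n j≤n) (m≤n⇒m≤1+n j′≤n) (begin
    suc (n i) ∸ j   ≡⟨ sym (cd-far ci (≰⇒> j≰) j≤n) ⟩
    cd i j          ≡⟨ +-cancelˡ-≡ (S i) _ _ eq ⟩
    cd i j′         ≡⟨ cd-far ci (≰⇒> j′≰) j′≤n ⟩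
    suc (n i) ∸ j′  ∎))
    where open ≡-Reasoning

  Π₃-resolving : Resolving G Π₃
  Π₃-resolving = singleton-class-resolves Π₃ root root-alone φ root-distance separates
    where
      separates : ∀ u w → region (proj₁ u) ≡ region (proj₁ w) → φ u ≡ φ w → u ≡ w
      separates ((i , j) , r) ((i′ , j′) , r′) same-region same-φ
        with rep-decode i j r | rep-decode i′ j′ r′
      ... | v , ng | v′ , ng′ = vertex-≡ (region-potential-injective v ng v′ ng′
              (region-view i j) (subst (Region i′ j′) (sym same-region) (region-view i′ j′))
              same-φ)

  -- Colour position j of cycle i
  -- by the class of v^i_j.  Each cycle is monochromatic, since a colour has
  -- at most one boundary vertex; and v^{i+1}_1 lies on cycle i, so by
  -- induction every vertex has the colour of v^1_1, leaving a class empty.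
  module TwoPartition (Π : Partition G 2) (resolving : Resolving G Π) where
    open Partition Π

    colour : ℕ → ℕ → Fin 2
    colour i j with valid? i j
    ... | yes v = cls (vertex i j v)
    ... | no _  = zero

    colour-vertex : ∀ {i j} (v : Valid i j) → colour i j ≡ cls (vertex i j v)
    colour-vertex {i} {j} v with valid? i j
    ... | yes v′ = cong cls (vertex-≡ refl)
    ... | no ¬v  = ⊥-elim (¬v v)

    module _ {i} (ci : IsCycle i) where
      open CycleColouring (n i) (cycle-long ci) (colour i)

      step-edge : ∀ {p q} → Step p q → CycleEdge m n i p q
      step-edge (inj₁ (1≤p , p<n , q≡)) = proj₁ ci , proj₂ ci , 1≤p , inj₁ (p<n , q≡)
      step-edge (inj₂ (p≡n , q≡1)) =
        proj₁ ci , proj₂ ci , subst (1 ≤_) (sym p≡n) (≤-trans (s≤s z≤n) (cycle-long ci)) ,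
        inj₂ (p≡n , q≡1)

      BoundaryVertex : ℕ → Set
      BoundaryVertex p = Σ (Valid i p) λ v → Σ V λ x →
        ChainAdj m n (vertex i p v) x × cls x ≢ cls (vertex i p v)

      boundary-vertex : ∀ {p} → Boundary p → BoundaryVertex p
      boundary-vertex {p} (q , inj₁ s , other) =
        proj₁ (edge-valid e) , _ , edge-adj e , λ same → other
          (trans (colour-vertex (proj₂ (edge-valid e)))
                 (trans same (sym (colour-vertex (proj₁ (edge-valid e))))))
        where
          e : CycleEdge m n i p q
          e = step-edge s
      boundary-vertex {p} (q , inj₂ s , other) =
        proj₂ (edge-valid e) , _ , edge-adj⁻ e , λ same → other
          (trans (colour-vertex (proj₁ (edge-valid e)))
                 (trans same (sym (colour-vertex (proj₂ (edge-valid e))))))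
        where
          e : CycleEdge m n i q p
          e = step-edge s

      cycle-monochromatic : ∀ {j} → 1 ≤ j → j ≤ n i → colour i j ≡ colour i 1
      cycle-monochromatic = monochromatic unique-boundary
        where
          unique-boundary : ∀ {p p′} → Boundary p → Boundary p′ →
            colour i p ≡ colour i p′ → p ≡ p′
          unique-boundary bp bp′ same with boundary-vertex bp | boundary-vertex bp′
          ... | v , x , ax , x-other | v′ , y , ay , y-other =
            vertex-injective v v′ (boundary-unique Π resolving
              (trans (sym (colour-vertex v)) (trans same (colour-vertex v′)))
              ax x-other ay y-other)

    first-vertex-colour : ∀ {i} → IsCycle i → colour i 1 ≡ cls root
    first-vertex-colour {suc zero} _ = colour-vertex root-valid
    first-vertex-colour {suc (suc k)} ci = begin
      colour (suc (suc k)) 1              ≡⟨ colour-vertex first ⟩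
      cls (vertex (suc (suc k)) 1 first)  ≡⟨ cong cls (glued ck first) ⟩
      cls (vertex (suc k) junction (junction-valid ck))
                                          ≡⟨ sym (colour-vertex (junction-valid ck)) ⟩
      colour (suc k) junction             ≡⟨ cycle-monochromatic ck (s≤s z≤n)
                                               (proj₂ (proj₂ (junction-valid ck))) ⟩
      colour (suc k) 1                    ≡⟨ first-vertex-colour ck ⟩
      cls root                            ∎
      where
        open ≡-Reasoning
        ck : IsCycle (suc k)
        ck = previous-cycle ci
        junction : ℕ
        junction = suc (suc (t (suc k)))
        first : Valid (suc (suc k)) 1
        first = ci , s≤s z≤n , ≤-trans (s≤s z≤n) (cycle-long ci)

    all-root-colour : ∀ u → cls u ≡ cls root
    all-root-colour ((i , j) , r) = begin
      cls ((i , j) , r)  ≡⟨ cong cls (vertex-self i j r) ⟩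
      cls (vertex i j v) ≡⟨ sym (colour-vertex v) ⟩
      colour i j         ≡⟨ cycle-monochromatic (proj₁ v) (proj₁ (proj₂ v)) (proj₂ (proj₂ v)) ⟩
      colour i 1         ≡⟨ first-vertex-colour (proj₁ v) ⟩
      cls root           ∎
      where
        open ≡-Reasoning
        v : Valid i j
        v = proj₁ (rep-decode i j r)

    one-colour : zero ≡ suc zero
    one-colour with nonempty zero | nonempty (suc zero)
    ... | q₀ , q₀∈ | q₁ , q₁∈ =
      trans (sym q₀∈) (trans (all-root-colour q₀) (trans (sym (all-root-colour q₁)) q₁∈))

  no-resolving-2-partition : (Π : Partition G 2) → ¬ Resolving G Π
  no-resolving-2-partition Π resolving with TwoPartition.one-colour Π resolving
  ... | ()

theorem2p5 : (m : ℕ) (n : ℕ → ℕ) → 1 ≤ m →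
    (∀ i → 1 ≤ i → i ≤ m → 3 ≤ n i × Odd (n i)) →
    PartitionDimension (ChainCycle m n) 3
theorem2p5 m n m≥1 shape =
  (Π₃ , Π₃-resolving) ,
  three-classes-needed root second root≢second no-resolving-2-partition
  where
    open ChainCycleProof m n m≥1 shape
    open GraphFacts G using (three-classes-needed)
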